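{- Let $A=(a_{ij})$ be an $n\times n$ $(0,1)$-matrix and run Algorithm 1 (described in the context) on $A$. If at some stage of the run the arc $(a,b)$ has been visited, then the entry $a_{ab}$ is never set to $0$ at any later stage of the run.
   Context: The matrix $A$ represents a binary relation (digraph) on $\{1,\dots,n\}$: there is an arc $(i,j)$ iff $a_{ij}=1$, and setting $a_{ij}$ to $0$ is called deleting the arc $(i,j)$. Algorithm 1 modifies $A$ in place: for $i=1,2,\dots,n$ (in increasing order), for $j=1,2,\dots,n$ with $j\neq i$ (in increasing order), if currently $a_{ij}=1$, then for $k=1,2,\dots,n$: (a) if $k\neq j$ and currently $a_{ik}=0$, set $a_{jk}:=0$; (b) if $k\neq i$ and currently $a_{kj}=0$, set $a_{ki}:=0$. The final matrix is the output. An arc $(a,b)$ is said to be visited at a given stage of the run if at some earlier stage the outer loop had $i=a$, the middle loop had $j=b$, and the test "$a_{ij}=1$" was satisfied at that moment. -}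

module Defs where

open import Data.Bool using (Bool; true; false; not; _∧_; if_then_else_)
open import Data.Fin using (Fin; _≟_)
open import Data.Nat using (ℕ)
open import Data.List using (List; []; _∷_; _++_; [_]; foldl; allFin)
open import Data.Product using (_×_; _,_)
open import Relation.Nullary.Decidable using (⌊_⌋)

Mat : ℕ → Set
Mat n = Fin n → Fin n → Bool

clear : ∀ {n} → Mat n → Fin n → Fin n → Mat n
clear A x y r c = if ⌊ r ≟ x ⌋ ∧ ⌊ c ≟ y ⌋ then false else A r c

_==_ : ∀ {n} → Fin n → Fin n → Bool
x == y = ⌊ x ≟ y ⌋

-- Atomic events of the run (the log of stages):
--   visit i j   : middle loop at (i,j), j ≠ i, test a_ij = 1 succeeded
--   skip i j    : middle loop at (i,j), j ≠ i, test a_ij = 1 failed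
--   setZero x y : an assignment a_xy := 0 was executed
data Event (n : ℕ) : Set where
  visit   : Fin n → Fin n → Event n
  skip    : Fin n → Fin n → Event n
  setZero : Fin n → Fin n → Event n

State : ℕ → Set
State n = Mat n × List (Event n)

-- innermost loop body for given i, j and k: step (a), then step (b),
-- each reading the current matrix
inner : ∀ {n} → Fin n → Fin n → State n → Fin n → State n
inner i j (A , log) k = stepB (stepA (A , log))
  where
  stepA : _ → _
  stepA (A , log) =
    if not (k == j) ∧ not (A i k)
    then (clear A j k , log ++ [ setZero j k ])
    else (A , log)
  stepB : _ → _
  stepB (A , log) =
    if not (k == i) ∧ not (A k j)
    then (clear A k i , log ++ [ setZero k i ])
    else (A , log)

middle : ∀ {n} → Fin n → State n → Fin n → State n
middle {n} i (A , log) j =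
  if j == i then (A , log)
  else (if A i j
        then foldl (inner i j) (A , log ++ [ visit i j ]) (allFin n)
        else (A , log ++ [ skip i j ]))

outer : ∀ {n} → State n → Fin n → State n
outer {n} st i = foldl (middle i) st (allFin n)

run : ∀ {n} → Mat n → State n
run {n} A = foldl outer (A , []) (allFin n)

trace : ∀ {n} → Mat n → List (Event n)
trace A = Data.Product.proj₂ (run A)

-- When the arc (i,j) is visited, the inner loop deletes exactly the arcs (j,k) with a_ik = 0
-- and (k,i) with a_kj = 0, so that afterwards row j is contained in row i and column i in
-- column j.  Every visited arc (a,b) keeps this domination of row b by row a and of column b
-- by column a for the rest of the run; this uses that a row whose loop is finished is
-- transitive through its visited arcs.  A deletion of (a,b) needs a k with a_bk = 1 and
-- a_ak = 0, or a_ka = 1 and a_kb = 0, which domination rules out.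
module Submission where

open import Data.Bool using (Bool; true; false; not; _∧_)
open import Data.Bool.Properties using (not-¬; ¬-not)
open import Data.Empty using (⊥-elim)
open import Data.Fin using (Fin; toℕ; zero; suc; _≟_)
open import Data.List using (List; []; _∷_; _++_; [_]; foldl; allFin; length; lookup)
open import Data.List.Properties using (++-assoc; ++-identityʳ)
open import Data.List.Membership.Propositional using (_∈_; _∉_)
open import Data.List.Membership.Propositional.Properties
  using (∈-++⁺ˡ; ∈-++⁺ʳ; ∈-++⁻; ∈-lookup; ∈-allFin)
open import Data.List.Relation.Unary.Any using (here; there)
open import Data.Nat using (ℕ; _<_; s≤s)
open import Data.Product using (_×_; _,_; proj₁; proj₂; map₂)
open import Data.Sum using (_⊎_; inj₁; inj₂)
open import Data.Unit using (⊤; tt)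
open import Function using (_∘_)
open import Relation.Nullary using (¬_; yes; no)
open import Relation.Binary.PropositionalEquality using (_≡_; _≢_; refl; sym; trans; cong; subst)
open import Defs

foldl-invariant : ∀ {X S : Set} (f : S → X → S) (P : List X → S → Set) →
                  (∀ ys x s → P ys s → P (ys ++ [ x ]) (f s x)) →
                  ∀ xs {ys s} → P ys s → P (ys ++ xs) (foldl f s xs)
foldl-invariant f P step []       {ys} {s} p = subst (λ zs → P zs s) (sym (++-identityʳ ys)) p
foldl-invariant f P step (x ∷ xs) {ys} {s} p =
  subst (λ zs → P zs (foldl f (f s x) xs)) (++-assoc ys [ x ] xs)
        (foldl-invariant f P step xs (step ys x s p))

∈-snoc⁻ : ∀ {A : Set} {x y : A} xs → x ∈ xs ++ [ y ] → x ∈ xs ⊎ x ≡ y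
∈-snoc⁻ xs x∈ with ∈-++⁻ xs x∈
... | inj₁ x∈xs       = inj₁ x∈xs
... | inj₂ (here x≡y) = inj₂ x≡y

module _ {n : ℕ} where

  VisitsKept : List (Event n) → Set
  VisitsKept []      = ⊤
  VisitsKept (e ∷ L) = (∀ a b → e ≡ visit a b → setZero a b ∉ L) × VisitsKept L

  visitsKept-lookup : ∀ L → VisitsKept L → (a b : Fin n) (s t : Fin (length L)) →
                      toℕ s < toℕ t → lookup L s ≡ visit a b → lookup L t ≢ setZero a b
  visitsKept-lookup (e ∷ L) (kept , _) a b zero (suc t) _ e≡ t≡ =
    kept a b e≡ (subst (_∈ L) t≡ (∈-lookup t))
  visitsKept-lookup (e ∷ L) (_ , keptL) a b (suc s) (suc t) (s≤s s<t) =
    visitsKept-lookup L keptL a b s t s<t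

  visitsKept-noVisits : ∀ E → (∀ a b → visit a b ∉ E) → VisitsKept E
  visitsKept-noVisits []      _        = tt
  visitsKept-noVisits (e ∷ E) noVisits =
    (λ { a b refl _ → noVisits a b (here refl) }) ,
    visitsKept-noVisits E (λ a b → noVisits a b ∘ there)

  visitsKept-++ : ∀ L {E} → VisitsKept L → VisitsKept E →
                  (∀ a b → visit a b ∈ L → setZero a b ∉ E) → VisitsKept (L ++ E)
  visitsKept-++ []      _              keptE _       = keptE
  visitsKept-++ (e ∷ L) {E} (keptₑ , keptL) keptE disjoint =
    kept , visitsKept-++ L keptL keptE (λ a b → disjoint a b ∘ there)
    where
    kept : ∀ a b → e ≡ visit a b → setZero a b ∉ L ++ E
    kept a b e≡ z∈ with ∈-++⁻ L z∈
    ... | inj₁ z∈L = keptₑ a b e≡ z∈L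
    ... | inj₂ z∈E = disjoint a b (here (sym e≡)) z∈E

  clear-self : ∀ (A : Mat n) x y → clear A x y x y ≡ false
  clear-self A x y with x ≟ x | y ≟ y
  ... | yes _   | yes _   = refl
  ... | no x≢x  | _       = ⊥-elim (x≢x refl)
  ... | yes _   | no y≢y  = ⊥-elim (y≢y refl)

  clear-≤ : ∀ (A : Mat n) x y r c → clear A x y r c ≡ true → A r c ≡ true
  clear-≤ A x y r c cleared with r ≟ x | c ≟ y
  ... | yes _ | yes _ = ⊥-elim (not-¬ cleared refl)
  ... | yes _ | no _  = cleared
  ... | no _  | _     = cleared

  clear-preserves-false : ∀ (A : Mat n) x y r c → A r c ≡ false → clear A x y r c ≡ false
  clear-preserves-false A x y r c A≡false with r ≟ x | c ≟ y
  ... | yes _ | yes _ = refl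
  ... | yes _ | no _  = A≡false
  ... | no _  | _     = A≡false

  guard : Fin n → Fin n → Bool → Bool
  guard k m b = not (k == m) ∧ not b

  guard-true : ∀ k m b → guard k m b ≡ true → k ≢ m × b ≡ false
  guard-true k m b g with k ≟ m
  guard-true k m false g  | no k≢m = k≢m , refl
  guard-true k m true  () | no _

  guard-false : ∀ k m b → guard k m b ≡ false → k ≡ m ⊎ b ≡ true
  guard-false k m b g with k ≟ m
  guard-false k m b     g  | yes k≡m = inj₁ k≡m
  guard-false k m true  g  | no _    = inj₂ refl
  guard-false k m false () | no _

  clearWhen : Bool → State n → Fin n → Fin n → State n
  clearWhen true  (A , L) x y = clear A x y , L ++ [ setZero x y ]
  clearWhen false st      x y = st

  clearWhen-preserves-false : ∀ b st x y r c → proj₁ st r c ≡ false →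
                              proj₁ (clearWhen b st x y) r c ≡ false
  clearWhen-preserves-false true  (A , L) x y r c = clear-preserves-false A x y r c
  clearWhen-preserves-false false st      x y r c A≡false = A≡false

  inner-clearWhen : ∀ i j (A : Mat n) L k →
    inner i j (A , L) k ≡
      (let st = clearWhen (guard k j (A i k)) (A , L) j k
       in clearWhen (guard k i (proj₁ st k j)) st k i)
  inner-clearWhen i j A L k with guard k j (A i k)
  ... | true with guard k i (clear A j k k j)
  ...   | true  = refl
  ...   | false = refl
  inner-clearWhen i j A L k | false with guard k i (A k j)
  ...   | true  = refl
  ...   | false = refl

  record ExtendedByClears (D : Fin n → Fin n → Set) (L L′ : List (Event n)) : Set where
    field
      suffix    : List (Event n)
      extends   : L′ ≡ L ++ suffix
      no-visits : ∀ a b → visit a b ∉ suffix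
      cleared   : ∀ x y → setZero x y ∈ suffix → D x y

    visit-∈⁻ : ∀ {a b} → visit a b ∈ L′ → visit a b ∈ L
    visit-∈⁻ {a} {b} v∈ with ∈-++⁻ L (subst (visit a b ∈_) extends v∈)
    ... | inj₁ v∈L      = v∈L
    ... | inj₂ v∈suffix = ⊥-elim (no-visits a b v∈suffix)

    ∈⁺ : ∀ {e} → e ∈ L → e ∈ L′
    ∈⁺ e∈ = subst (_ ∈_) (sym extends) (∈-++⁺ˡ e∈)

    visitsKept : VisitsKept L → (∀ x y → D x y → visit x y ∉ L) → VisitsKept L′
    visitsKept keptL unvisited =
      subst VisitsKept (sym extends)
        (visitsKept-++ L keptL (visitsKept-noVisits suffix no-visits)
           (λ a b v∈ z∈ → unvisited a b (cleared a b z∈) v∈))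

  extendedByClears-refl : ∀ {D} L → ExtendedByClears D L L
  extendedByClears-refl L = record
    { suffix = [] ; extends = sym (++-identityʳ L) ; no-visits = λ _ _ () ; cleared = λ _ _ () }

  extendedByClears-snoc : ∀ {D L L′} x y → ExtendedByClears D L L′ → D x y →
                          ExtendedByClears D L (L′ ++ [ setZero x y ])
  extendedByClears-snoc {D} {L} x y ext Dxy = record
    { suffix    = suffix ++ [ setZero x y ]
    ; extends   = trans (cong (_++ [ setZero x y ]) extends) (++-assoc L suffix [ setZero x y ])
    ; no-visits = no-visits′
    ; cleared   = cleared′
    }
    where
    open ExtendedByClears ext
    no-visits′ : ∀ a b → visit a b ∉ suffix ++ [ setZero x y ]
    no-visits′ a b v∈ with ∈-snoc⁻ suffix v∈
    ... | inj₁ v∈suffix = no-visits a b v∈suffix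
    cleared′ : ∀ a b → setZero a b ∈ suffix ++ [ setZero x y ] → D a b
    cleared′ a b z∈ with ∈-snoc⁻ suffix z∈
    ... | inj₁ z∈suffix = cleared a b z∈suffix
    ... | inj₂ refl     = Dxy

  -- the arcs deleted by steps (a) and (b) while (i,j) is visited, starting from the matrix M
  Deleted : Mat n → Fin n → Fin n → Fin n → Fin n → Set
  Deleted M i j r c = (r ≡ j × c ≢ j × M i c ≡ false) ⊎ (c ≡ i × r ≢ i × M r j ≡ false)

  module InnerLoop (i j : Fin n) (j≢i : j ≢ i) (M : Mat n) (L₀ : List (Event n)) where

    D : Fin n → Fin n → Set
    D = Deleted M i j

    deleted-row≢ : ∀ {r c} → D r c → r ≢ i
    deleted-row≢ (inj₁ (refl , _ , _))   = j≢i
    deleted-row≢ (inj₂ (_ , r≢i , _))    = r≢i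

    deleted-col≢ : ∀ {r c} → D r c → c ≢ j
    deleted-col≢ (inj₁ (_ , c≢j , _))    = c≢j
    deleted-col≢ (inj₂ (refl , _ , _))   = j≢i ∘ sym

    record Partial (ks : List (Fin n)) (st : State n) : Set where
      field
        below        : ∀ r c → proj₁ st r c ≡ true → M r c ≡ true
        only-deleted : ∀ r c → M r c ≡ true → proj₁ st r c ≡ false → D r c
        row-done     : ∀ k → k ∈ ks → k ≢ j → M i k ≡ false → proj₁ st j k ≡ false
        col-done     : ∀ k → k ∈ ks → k ≢ i → M k j ≡ false → proj₁ st k i ≡ false
        log          : ExtendedByClears D L₀ (proj₂ st)

    partial-start : Partial [] (M , L₀)
    partial-start = record
      { below        = λ _ _ M≡ → M≡
      ; only-deleted = λ _ _ M≡true M≡false → ⊥-elim (not-¬ M≡true M≡false)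
      ; row-done     = λ _ ()
      ; col-done     = λ _ ()
      ; log          = extendedByClears-refl L₀
      }

    partial-unchanged : ∀ {ks} st → Partial ks st → ∀ r c → ¬ D r c → proj₁ st r c ≡ M r c
    partial-unchanged st p r c ¬D with M r c in M≡ | proj₁ st r c in A≡
    ... | true  | true  = refl
    ... | true  | false = ⊥-elim (¬D (Partial.only-deleted p r c M≡ A≡))
    ... | false | true  = ⊥-elim (not-¬ (Partial.below p r c A≡) M≡)
    ... | false | false = refl

    partial-clear : ∀ {ks A L} x y → Partial ks (A , L) → D x y →
                    Partial ks (clear A x y , L ++ [ setZero x y ])
    partial-clear {A = A} x y p Dxy = record
      { below        = λ r c A≡ → below r c (clear-≤ A x y r c A≡)
      ; only-deleted = only-deleted′
      ; row-done     = λ k k∈ k≢j M≡ → clear-preserves-false A x y j k (row-done k k∈ k≢j M≡)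
      ; col-done     = λ k k∈ k≢i M≡ → clear-preserves-false A x y k i (col-done k k∈ k≢i M≡)
      ; log          = extendedByClears-snoc x y log Dxy
      }
      where
      open Partial p
      only-deleted′ : ∀ r c → M r c ≡ true → clear A x y r c ≡ false → D r c
      only-deleted′ r c M≡ A≡ with r ≟ x | c ≟ y
      ... | yes refl | yes refl = Dxy
      ... | yes _    | no _     = only-deleted r c M≡ A≡
      ... | no _     | _        = only-deleted r c M≡ A≡

    -- one of the two steps (a), (b): test entry (p,q), which the loop never changes, and
    -- possibly delete (x,y)
    partial-step : ∀ {ks} k m p q x y st → Partial ks st → ¬ D p q →
                   (k ≢ m → M p q ≡ false → D x y) →
                   let st′ = clearWhen (guard k m (proj₁ st p q)) st x y
                   in Partial ks st′ × (k ≢ m → M p q ≡ false → proj₁ st′ x y ≡ false)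
    partial-step k m p q x y (A , L) part ¬Dpq deletes
      with guard k m (A p q) in g
    ... | true  = partial-clear x y part (deletes k≢m Mpq≡false) , λ _ _ → clear-self A x y
      where
      k≢m : k ≢ m
      k≢m = proj₁ (guard-true k m (A p q) g)
      Mpq≡false : M p q ≡ false
      Mpq≡false = trans (sym (partial-unchanged (A , L) part p q ¬Dpq)) (proj₂ (guard-true k m (A p q) g))
    ... | false = part , not-tested
      where
      not-tested : k ≢ m → M p q ≡ false → A x y ≡ false
      not-tested k≢m Mpq≡false with guard-false k m (A p q) g
      ... | inj₁ k≡m   = ⊥-elim (k≢m k≡m)
      ... | inj₂ Apq≡  = ⊥-elim (not-¬ (Partial.below part p q Apq≡) Mpq≡false)

    partial-snoc : ∀ {ks} k st → Partial ks st →
                   (k ≢ j → M i k ≡ false → proj₁ st j k ≡ false) →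
                   (k ≢ i → M k j ≡ false → proj₁ st k i ≡ false) →
                   Partial (ks ++ [ k ]) st
    partial-snoc {ks} k st p row-k col-k = record
      { below = below ; only-deleted = only-deleted
      ; row-done = row-done′ ; col-done = col-done′ ; log = log }
      where
      open Partial p
      row-done′ : ∀ k′ → k′ ∈ ks ++ [ k ] → k′ ≢ j → M i k′ ≡ false → proj₁ st j k′ ≡ false
      row-done′ k′ k′∈ with ∈-snoc⁻ ks k′∈
      ... | inj₁ k′∈ks = row-done k′ k′∈ks
      ... | inj₂ refl  = row-k
      col-done′ : ∀ k′ → k′ ∈ ks ++ [ k ] → k′ ≢ i → M k′ j ≡ false → proj₁ st k′ i ≡ false
      col-done′ k′ k′∈ with ∈-snoc⁻ ks k′∈
      ... | inj₁ k′∈ks = col-done k′ k′∈ks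
      ... | inj₂ refl  = col-k

    partial-inner : ∀ ks k st → Partial ks st → Partial (ks ++ [ k ]) (inner i j st k)
    partial-inner ks k (A , L) part rewrite inner-clearWhen i j A L k =
      partial-snoc k stB (proj₁ stepB) row-k (proj₂ stepB)
      where
      stA stB : State n
      stA = clearWhen (guard k j (A i k)) (A , L) j k
      stB = clearWhen (guard k i (proj₁ stA k j)) stA k i
      stepA : Partial ks stA × (k ≢ j → M i k ≡ false → proj₁ stA j k ≡ false)
      stepA = partial-step k j i k j k (A , L) part (λ Dik → deleted-row≢ Dik refl)
                           (λ k≢j Mik≡ → inj₁ (refl , k≢j , Mik≡))
      stepB : Partial ks stB × (k ≢ i → M k j ≡ false → proj₁ stB k i ≡ false)
      stepB = partial-step k i k j k i stA (proj₁ stepA) (λ Dkj → deleted-col≢ Dkj refl)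
                           (λ k≢i Mkj≡ → inj₂ (refl , k≢i , Mkj≡))
      row-k : k ≢ j → M i k ≡ false → proj₁ stB j k ≡ false
      row-k k≢j Mik≡ =
        clearWhen-preserves-false (guard k i (proj₁ stA k j)) stA k i j k (proj₂ stepA k≢j Mik≡)

    final : State n
    final = foldl (inner i j) (M , L₀) (allFin n)

    partial-final : Partial (allFin n) final
    partial-final = foldl-invariant (inner i j) Partial partial-inner (allFin n) partial-start

    open Partial partial-final public using (below; log)

    kept : ∀ r c → M r c ≡ true → ¬ D r c → proj₁ final r c ≡ true
    kept r c Mrc≡ ¬D = trans (partial-unchanged final partial-final r c ¬D) Mrc≡

    removed : ∀ r c → D r c → proj₁ final r c ≡ false
    removed r c (inj₁ (refl , c≢j , Mic≡)) = Partial.row-done partial-final c (∈-allFin c) c≢j Mic≡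
    removed r c (inj₂ (refl , r≢i , Mrj≡)) = Partial.col-done partial-final r (∈-allFin r) r≢i Mrj≡

  record Dominates (A : Mat n) (a b : Fin n) : Set where
    field
      arc  : A a b ≡ true
      row⊆ : ∀ k → A b k ≡ true → A a k ≡ true
      col⊆ : ∀ k → A k a ≡ true → A k b ≡ true

  record Invariant (Processed : Fin n → Fin n → Set) (st : State n) : Set where
    field
      dominates         : ∀ a b → visit a b ∈ proj₂ st → Dominates (proj₁ st) a b
      visited-processed : ∀ a b → visit a b ∈ proj₂ st → a ≢ b × Processed a b
      processed-visited : ∀ a b → Processed a b → a ≢ b → proj₁ st a b ≡ true → visit a b ∈ proj₂ st
      visitsKept        : VisitsKept (proj₂ st)

    row-transitive : ∀ {a x k} → (∀ b → Processed a b) →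
                     proj₁ st x a ≡ true → proj₁ st a k ≡ true → proj₁ st x k ≡ true
    row-transitive {a} {x} {k} row-a xa ak with a ≟ k
    ... | yes refl = xa
    ... | no a≢k   = Dominates.col⊆ (dominates a k (processed-visited a k (row-a k) a≢k ak)) x xa

  invariant-reindex : ∀ {P Q st} → (∀ a b → P a b → Q a b) → (∀ a b → Q a b → P a b) →
                      Invariant P st → Invariant Q st
  invariant-reindex P⇒Q Q⇒P inv = record
    { dominates         = dominates
    ; visited-processed = λ a b → map₂ (P⇒Q a b) ∘ visited-processed a b
    ; processed-visited = λ a b → processed-visited a b ∘ Q⇒P a b
    ; visitsKept        = visitsKept
    }
    where open Invariant inv

  invariant-skip : ∀ {P A L} i j → Invariant P (A , L) → Invariant P (A , L ++ [ skip i j ])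
  invariant-skip {L = L} i j inv = record
    { dominates         = λ a b → dominates a b ∘ visit-∈⁻
    ; visited-processed = λ a b → visited-processed a b ∘ visit-∈⁻
    ; processed-visited = λ a b p a≢b Aab → ∈-++⁺ˡ (processed-visited a b p a≢b Aab)
    ; visitsKept        = visitsKept-++ L visitsKept ((λ _ _ ()) , tt) (λ { _ _ _ (here ()) })
    }
    where
    open Invariant inv
    visit-∈⁻ : ∀ {a b} → visit a b ∈ L ++ [ skip i j ] → visit a b ∈ L
    visit-∈⁻ v∈ with ∈-snoc⁻ L v∈
    ... | inj₁ v∈L = v∈L

  Processed : List (Fin n) → Fin n → List (Fin n) → Fin n → Fin n → Set
  Processed rows i js a b = a ∈ rows ⊎ (a ≡ i × b ∈ js)

  processed-snoc⁻ : ∀ {rows i js j a b} → Processed rows i (js ++ [ j ]) a b →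
                    Processed rows i js a b ⊎ (a ≡ i × b ≡ j)
  processed-snoc⁻         (inj₁ a∈)        = inj₁ (inj₁ a∈)
  processed-snoc⁻ {js = js} (inj₂ (a≡i , b∈)) with ∈-snoc⁻ js b∈
  ... | inj₁ b∈js = inj₁ (inj₂ (a≡i , b∈js))
  ... | inj₂ b≡j  = inj₂ (a≡i , b≡j)

  processed-snoc⁺ : ∀ {rows i js j a b} → Processed rows i js a b → Processed rows i (js ++ [ j ]) a b
  processed-snoc⁺         (inj₁ a∈)        = inj₁ a∈
  processed-snoc⁺ {js = js} (inj₂ (a≡i , b∈)) = inj₂ (a≡i , ∈-++⁺ˡ b∈)

  invariant-unvisited : ∀ {rows i js j A L} → (i ≢ j → A i j ≡ false) →
                        Invariant (Processed rows i js) (A , L) →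
                        Invariant (Processed rows i (js ++ [ j ])) (A , L)
  invariant-unvisited {rows} {i} {js} {j} {A} {L} Aij≡false inv = record
    { dominates         = dominates
    ; visited-processed = λ a b → map₂ processed-snoc⁺ ∘ visited-processed a b
    ; processed-visited = processed-visited′
    ; visitsKept        = visitsKept
    }
    where
    open Invariant inv
    processed-visited′ : ∀ a b → Processed rows i (js ++ [ j ]) a b → a ≢ b → A a b ≡ true → visit a b ∈ L
    processed-visited′ a b p a≢b Aab with processed-snoc⁻ p
    ... | inj₁ p′            = processed-visited a b p′ a≢b Aab
    ... | inj₂ (refl , refl) = ⊥-elim (not-¬ Aab (Aij≡false a≢b))

  module VisitStep {rows i js A L} (inv : Invariant (Processed rows i js) (A , L))
                   (j : Fin n) (j≢i : j ≢ i) (Aij : A i j ≡ true) where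
    open Invariant inv
    open InnerLoop i j j≢i A (L ++ [ visit i j ])

    A′ : Mat n
    A′ = proj₁ final

    survives : ∀ {r c} → A′ r c ≡ true → ¬ D r c
    survives {r} {c} A′rc Drc = not-¬ A′rc (removed r c Drc)

    visit-∈⁻ : ∀ {a b} → visit a b ∈ L ++ [ visit i j ] → visit a b ∈ L ⊎ (a ≡ i × b ≡ j)
    visit-∈⁻ v∈ with ∈-snoc⁻ L v∈
    ... | inj₁ v∈L  = inj₁ v∈L
    ... | inj₂ refl = inj₂ (refl , refl)

    dominated-undeleted : ∀ {a b} → Dominates A a b → ¬ D a b
    dominated-undeleted d (inj₁ (refl , _ , Aib≡false)) = not-¬ (Dominates.col⊆ d i Aij) Aib≡false
    dominated-undeleted d (inj₂ (refl , _ , Aaj≡false)) = not-¬ (Dominates.row⊆ d j Aij) Aaj≡false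

    deleted-unvisited : ∀ x y → D x y → visit x y ∉ L ++ [ visit i j ]
    deleted-unvisited x y Dxy v∈ with visit-∈⁻ v∈
    ... | inj₁ v∈L          = dominated-undeleted (dominates x y v∈L) Dxy
    ... | inj₂ (refl , _)   = deleted-row≢ Dxy refl

    row-j⊆row-i : ∀ k → A′ j k ≡ true → A i k ≡ true
    row-j⊆row-i k A′jk with k ≟ j
    ... | yes refl = Aij
    ... | no k≢j   = ¬-not λ Aik≡false → survives A′jk (inj₁ (refl , k≢j , Aik≡false))

    col-i⊆col-j : ∀ k → A′ k i ≡ true → A k j ≡ true
    col-i⊆col-j k A′ki with k ≟ i
    ... | yes refl = Aij
    ... | no k≢i   = ¬-not λ Akj≡false → survives A′ki (inj₂ (refl , k≢i , Akj≡false))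

    dominates-new : Dominates A′ i j
    dominates-new = record
      { arc  = kept i j Aij (λ Dij → deleted-row≢ Dij refl)
      ; row⊆ = λ k A′jk → kept i k (row-j⊆row-i k A′jk) (λ Dik → deleted-row≢ Dik refl)
      ; col⊆ = λ k A′ki → kept k j (col-i⊆col-j k A′ki) (λ Dkj → deleted-col≢ Dkj refl)
      }

    dominates-old : ∀ a b → visit a b ∈ L → Dominates A′ a b
    dominates-old a b v∈ =
      record { arc = kept a b arc (dominated-undeleted d) ; row⊆ = row⊆′ ; col⊆ = col⊆′ }
      where
      d : Dominates A a b
      d = dominates a b v∈
      open Dominates d
      a≢b : a ≢ b
      a≢b = proj₁ (visited-processed a b v∈)
      a-processed : Processed rows i js a b
      a-processed = proj₂ (visited-processed a b v∈)
      row⊆′ : ∀ k → A′ b k ≡ true → A′ a k ≡ true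
      row⊆′ k A′bk = kept a k (row⊆ k (below b k A′bk)) undeleted
        where
        undeleted : ¬ D a k
        undeleted (inj₁ (refl , _ , Aik≡false)) with a-processed
        ... | inj₁ j∈rows    =
          not-¬ (row-transitive (λ _ → inj₁ j∈rows) Aij (row⊆ k (below b k A′bk))) Aik≡false
        ... | inj₂ (j≡i , _) = j≢i j≡i
        undeleted (inj₂ (refl , _ , Aaj≡false)) = not-¬ (row⊆ j (col-i⊆col-j b A′bk)) Aaj≡false
      col⊆′ : ∀ k → A′ k a ≡ true → A′ k b ≡ true
      col⊆′ k A′ka = kept k b (col⊆ k (below k a A′ka)) undeleted
        where
        undeleted : ¬ D k b
        undeleted (inj₁ (refl , _ , Aib≡false)) = not-¬ (col⊆ i (row-j⊆row-i a A′ka)) Aib≡false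
        undeleted (inj₂ (refl , _ , Akj≡false)) with a-processed
        ... | inj₁ a∈rows    =
          not-¬ (row-transitive (λ _ → inj₁ a∈rows) (below k a A′ka) (row⊆ j Aij)) Akj≡false
        ... | inj₂ (a≡i , _) = a≢b a≡i

    invariant-visit : Invariant (Processed rows i (js ++ [ j ])) final
    invariant-visit = record
      { dominates         = dominates′
      ; visited-processed = visited-processed′
      ; processed-visited = processed-visited′
      ; visitsKept        = ExtendedByClears.visitsKept log
                              (visitsKept-++ L visitsKept ((λ _ _ _ ()) , tt) (λ { _ _ _ (here ()) }))
                              deleted-unvisited
      }
      where
      dominates′ : ∀ a b → visit a b ∈ proj₂ final → Dominates A′ a b
      dominates′ a b v∈ with visit-∈⁻ (ExtendedByClears.visit-∈⁻ log v∈)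
      ... | inj₁ v∈L           = dominates-old a b v∈L
      ... | inj₂ (refl , refl) = dominates-new
      visited-processed′ : ∀ a b → visit a b ∈ proj₂ final → a ≢ b × Processed rows i (js ++ [ j ]) a b
      visited-processed′ a b v∈ with visit-∈⁻ (ExtendedByClears.visit-∈⁻ log v∈)
      ... | inj₁ v∈L           = map₂ processed-snoc⁺ (visited-processed a b v∈L)
      ... | inj₂ (refl , refl) = j≢i ∘ sym , inj₂ (refl , ∈-++⁺ʳ js (here refl))
      processed-visited′ : ∀ a b → Processed rows i (js ++ [ j ]) a b → a ≢ b → A′ a b ≡ true →
                           visit a b ∈ proj₂ final
      processed-visited′ a b p a≢b A′ab with processed-snoc⁻ p
      ... | inj₁ p′            =
        ExtendedByClears.∈⁺ log (∈-++⁺ˡ (processed-visited a b p′ a≢b (below a b A′ab)))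
      ... | inj₂ (refl , refl) = ExtendedByClears.∈⁺ log (∈-++⁺ʳ L (here refl))

  invariant-middle : ∀ rows i js j st → Invariant (Processed rows i js) st →
                     Invariant (Processed rows i (js ++ [ j ])) (middle i st j)
  invariant-middle rows i js j (A , L) inv with j ≟ i
  ... | yes refl = invariant-unvisited (λ i≢i → ⊥-elim (i≢i refl)) inv
  ... | no j≢i with A i j in Aij
  ...   | true  = VisitStep.invariant-visit inv j j≢i Aij
  ...   | false = invariant-skip i j (invariant-unvisited (λ _ → Aij) inv)

  RowsDone : List (Fin n) → State n → Set
  RowsDone rows = Invariant (λ a _ → a ∈ rows)

  rowsDone-outer : ∀ rows i st → RowsDone rows st → RowsDone (rows ++ [ i ]) (outer st i)
  rowsDone-outer rows i st done =
    invariant-reindex row-finished row-finished⁻¹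
      (foldl-invariant (middle i) (λ js → Invariant (Processed rows i js)) (invariant-middle rows i)
        (allFin n)
        (invariant-reindex (λ _ _ → inj₁) (λ { _ _ (inj₁ a∈) → a∈ }) done))
    where
    row-finished : ∀ a b → Processed rows i (allFin n) a b → a ∈ rows ++ [ i ]
    row-finished a b (inj₁ a∈rows)    = ∈-++⁺ˡ a∈rows
    row-finished a b (inj₂ (refl , _)) = ∈-++⁺ʳ rows (here refl)
    row-finished⁻¹ : ∀ a b → a ∈ rows ++ [ i ] → Processed rows i (allFin n) a b
    row-finished⁻¹ a b a∈ with ∈-snoc⁻ rows a∈
    ... | inj₁ a∈rows = inj₁ a∈rows
    ... | inj₂ a≡i    = inj₂ (a≡i , ∈-allFin b)

  rowsDone-run : ∀ (A : Mat n) → RowsDone (allFin n) (run A)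
  rowsDone-run A = foldl-invariant outer RowsDone rowsDone-outer (allFin n) rowsDone-start
    where
    rowsDone-start : RowsDone [] (A , [])
    rowsDone-start = record
      { dominates = λ _ _ () ; visited-processed = λ _ _ () ; processed-visited = λ _ _ () ; visitsKept = tt }

lemma1 : (n : ℕ) (A : Mat n) (a b : Fin n)
         (s t : Fin (length (trace A))) →
         toℕ s < toℕ t →
         lookup (trace A) s ≡ visit a b →
         lookup (trace A) t ≢ setZero a b
lemma1 n A = visitsKept-lookup (trace A) (Invariant.visitsKept (rowsDone-run A))
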